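{- Let $\mathcal C$ be any collection of languages over a countably infinite universe $U$. If there exists a countable sequence of collections $\mathcal C_0 \subseteq \mathcal C_1 \subseteq \cdots$ such that $\mathcal C = \bigcup_{i\in\mathbb N}\mathcal C_i$ and $\mathrm{NC}_1(\mathcal C_i) < \infty$ for all $i \in \mathbb N$, then $\mathcal C$ is non-uniformly noise-dependently generatable.
   Context: A language is an infinite subset of $U$; a collection is a (possibly uncountable) set of languages. For $i \in \mathbb N=\{0,1,\dots\}$, an enumeration of a language $K$ with noise level $i$ is an infinite sequence $x_0, x_1, \dots$ of elements of $U$ without repetitions such that $K \subseteq \{x_j : j \in \mathbb N\}$ and $|\{x_j : j\in\mathbb N\} \setminus K| \le i$. Write $S_t = \{x_0,\dots,x_t\}$. A generator algorithm is a function $G : U^* \to U$; at time $t$ it outputs $z_t = G(x_0,\dots,x_t)$. $G$ non-uniformly noise-dependently generates for $\mathcal C$ if for every $n^\star\in\mathbb N$ and every $K\in\mathcal C$ there exists $t^\star$ such that for every enumeration of $K$ with noise level $n^\star$ and all $t\ge t^\star$, $z_t\in K\setminus S_t$; $\mathcal C$ is non-uniformly noise-dependently generatable if such $G$ exists. For $S \subseteq U$, $\mathcal C(S,i) = \{L \in \mathcal C : |S\setminus L| \le i\}$; $\langle S\rangle_{\mathcal C,i} = \bigcap_{L\in\mathcal C(S,i)} L$ if $\mathcal C(S,i)\neq\emptyset$, else $\emptyset$. $\mathrm{NC}_i(\mathcal C)$ is the size of the largest finite set $S$ with $\mathcal C(S,i)\neq\emptyset$ and $|\langle S\rangle_{\mathcal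 C,i}|<\infty$, and $\infty$ if there are arbitrarily large such sets. -}

module Defs where

open import Data.Nat using (ℕ; suc; _≤_)
open import Data.Bool using (Bool; true; false)
open import Data.List using (List; length; map; upTo)
open import Data.List.Relation.Unary.All using (All)
open import Data.List.Relation.Unary.Unique.Propositional using (Unique)
open import Data.List.Membership.Propositional using (_∈_; _∉_)
open import Data.Product using (Σ; ∃; _×_)
open import Relation.Binary.PropositionalEquality using (_≡_)
open import Function.Definitions using (Injective)

Subset : Set → Set
Subset U = U → Bool

Collection : Set → Set₁
Collection U = Subset U → Set

Infinite : {U : Set} → Subset U → Set
Infinite {U} L = (xs : List U) → ∃ λ x → (L x ≡ true) × (x ∉ xs)

-- |{y : P y}| ≤ i : every duplicate-free list of elements satisfying P has length ≤ i.
AtMost : {U : Set} → (U → Set) → ℕ → Set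
AtMost {U} P i = (ys : List U) → Unique ys → All P ys → length ys ≤ i

FiniteSet : {U : Set} → (U → Set) → Set
FiniteSet P = ∃ λ d → AtMost P d

-- L ∈ C(S,i) : L ∈ C and |S \ L| ≤ i
InCS : {U : Set} → Collection U → List U → ℕ → Subset U → Set
InCS C S i L = C L × AtMost (λ y → (y ∈ S) × (L y ≡ false)) i

-- y ∈ ⟨S⟩_{C,i}  (empty when C(S,i) is empty)
InClosure : {U : Set} → Collection U → List U → ℕ → U → Set
InClosure C S i y = (∃ λ L → InCS C S i L) × (∀ L → InCS C S i L → L y ≡ true)

-- NC_i(C) ≤ d : every finite S (duplicate-free list) with C(S,i) ≠ ∅ and ⟨S⟩_{C,i} finite has |S| ≤ d
NCBound : {U : Set} → Collection U → ℕ → ℕ → Set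
NCBound {U} C i d =
  (S : List U) → Unique S → (∃ λ L → InCS C S i L) → FiniteSet (InClosure C S i) → length S ≤ d

NCFinite : {U : Set} → Collection U → ℕ → Set
NCFinite C i = ∃ λ d → NCBound C i d

Enumeration : {U : Set} → Subset U → ℕ → (ℕ → U) → Set
Enumeration {U} K i x =
  Injective _≡_ _≡_ x
  × ((y : U) → K y ≡ true → ∃ λ j → x j ≡ y)
  × AtMost (λ y → (∃ λ j → x j ≡ y) × (K y ≡ false)) i

prefix : {U : Set} → (ℕ → U) → ℕ → List U
prefix x t = map x (upTo (suc t))

NonUniformlyGenerates : {U : Set} → Collection U → (List U → U) → Set
NonUniformlyGenerates {U} C G =
  (nstar : ℕ) → (K : Subset U) → C K →
  ∃ λ tstar → (x : ℕ → U) → Enumeration K nstar x →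
    (t : ℕ) → tstar ≤ t →
    (K (G (prefix x t)) ≡ true) × (G (prefix x t) ∉ prefix x t)

NonUniformlyGeneratable : {U : Set} → Collection U → Set
NonUniformlyGeneratable {U} C = Σ (List U → U) λ G → NonUniformlyGenerates C G

-- If NC₁(C) ≤ d and NC_m(C) ≤ e then NC_{m+1}(C) ≤ (m + 1) + (d + 1)(e + 1). Take S with
-- L₀ ∈ C(S, m + 1) and ⟨S⟩_{m+1} finite but S longer than that; then S ∩ L₀ contains d + 1 disjoint
-- blocks A of e + 1 points. Since L₀ ∈ C(A, m), the bound NC_m ≤ e yields a point b ∈ ⟨A⟩_m outside
-- ⟨S⟩_{m+1}. Every L ∈ C(S, m + 1) missing b lies outside C(A, m), so it misses more than m points of A
-- and hence all its misses in S lie in A. Thus no such L misses two of the d + 1 points b, i.e.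
-- C(S, m + 1) ⊆ C(B, 1) for the set B of these points, and ⟨B⟩_1 ⊆ ⟨S⟩_{m+1} is finite, contradicting
-- NC₁ ≤ d. Iterating, NC_{k+1}(C_k) < ∞ for all k.
--
-- On a sample of size w the generator takes the largest level k ≤ w whose bound on NC_{k+1}(C_k) is
-- below w and outputs a point of ⟨sample⟩_{C_k, k+1} outside the sample, which exists because the
-- sample exceeds the NC bound. Once k is at least the index of K plus the noise level,
-- K ∈ C_k(sample, k + 1), so that closure lies inside K.
{-# OPTIONS --safe #-}
module Submission where

open import Defs
open import Level using (0ℓ)
open import Axiom.ExcludedMiddle using (ExcludedMiddle)
open import Axiom.DoubleNegationElimination using (DoubleNegationElimination; em⇒dne)
open import Data.Bool using (true; false; _≟_)
open import Data.Bool.Properties using (¬-not; not-¬)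
open import Data.Empty using (⊥-elim)
open import Data.Fin using (Fin; zero; suc)
open import Data.Fin.Properties using (injective⇒≤)
open import Data.List using (List; []; _∷_; _++_; length; lookup; upTo; filter; take; drop)
open import Data.List.Properties using (length-map; length-upTo; length-take; length-++; take++drop≡id)
open import Data.List.Membership.Propositional using (_∈_; _∉_)
open import Data.List.Membership.Propositional.Properties using (∈-lookup; ∈-map⁻; ∈-filter⁻; ∈-++⁺ˡ; ∈-++⁺ʳ)
open import Data.List.Relation.Unary.All as All using (All; _∷_)
open import Data.List.Relation.Unary.All.Properties using (¬Any⇒All¬)
open import Data.List.Relation.Unary.Any using (here; there; index)
open import Data.List.Relation.Unary.Any.Properties using (lookup-index)
open import Data.List.Relation.Unary.AllPairs using ([]; _∷_)
open import Data.List.Relation.Unary.Unique.Propositional using (Unique)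
import Data.List.Relation.Unary.Unique.Propositional.Properties as Unique
open import Data.Nat using (ℕ; zero; suc; _+_; _*_; _≤_; _<_; _≤′_; ≤′-refl; ≤′-step; z≤n; s≤s; s≤s⁻¹; _<?_)
open import Data.Nat.Properties
  using (+-suc; +-comm; +-monoʳ-≤; +-cancelˡ-≤; +-cancelˡ-<; ≤-trans; ≤-reflexive; <⇒≤; <-≤-trans; <⇒≱; ≮⇒≥;
         1+n≰n; n≤1+n; m≤m+n; m≤n+m; m≤n⇒m⊓n≡m; m≤n⇒m<n∨m≡n; ≤⇒≤′; module ≤-Reasoning)
open import Data.Product using (∃; _×_; _,_; proj₁; proj₂)
open import Data.Sum using (inj₁; inj₂)
open import Function.Bundles using (_↔_; _⇔_; Inverse; Equivalence)
open import Function.Definitions using (Injective)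
open import Relation.Binary.PropositionalEquality using (_≡_; refl; sym; trans; cong; subst; module ≡-Reasoning)
open import Relation.Nullary using (¬_; yes; no)
open import Relation.Unary using (Pred; _⊆_; Decidable)
open import Relation.Unary.Properties using (∁?)

module _ {a} {A : Set a} where

  lookup-injective : ∀ {xs : List A} {i j : Fin (length xs)} →
                     Unique xs → lookup xs i ≡ lookup xs j → i ≡ j
  lookup-injective {x ∷ xs} {zero}  {zero}  _          _  = refl
  lookup-injective {x ∷ xs} {zero}  {suc j} (x∉xs ∷ _) eq = ⊥-elim (All.lookup x∉xs (∈-lookup j) eq)
  lookup-injective {x ∷ xs} {suc i} {zero}  (x∉xs ∷ _) eq = ⊥-elim (All.lookup x∉xs (∈-lookup i) (sym eq))
  lookup-injective {x ∷ xs} {suc i} {suc j} (_ ∷ u)    eq = cong suc (lookup-injective u eq)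

  length-mono-⊆ : ∀ {xs ys : List A} → Unique ys → (_∈ ys) ⊆ (_∈ xs) → length ys ≤ length xs
  length-mono-⊆ {xs} {ys} u ys⊆xs = injective⇒≤ λ {i} {j} eq → lookup-injective u (begin
      lookup ys i                      ≡⟨ lookup-index (position i) ⟩
      lookup xs (index (position i))   ≡⟨ cong (lookup xs) eq ⟩
      lookup xs (index (position j))   ≡⟨ lookup-index (position j) ⟨
      lookup ys j                      ∎)
    where
    open ≡-Reasoning
    position : (i : Fin (length ys)) → lookup ys i ∈ xs
    position i = ys⊆xs (∈-lookup i)

  Unique-++⇒disjoint : ∀ (xs : List A) {ys y} → Unique (xs ++ ys) → y ∈ xs → y ∉ ys
  Unique-++⇒disjoint (x ∷ xs) (x∉ ∷ _) (here refl) y∈ys = All.lookup x∉ (∈-++⁺ʳ xs y∈ys) refl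
  Unique-++⇒disjoint (x ∷ xs) (_ ∷ u)  (there y∈xs) y∈ys = Unique-++⇒disjoint xs u y∈xs y∈ys

  module _ {p} {P : Pred A p} (P? : Decidable P) where

    length-filter+filter∁ : ∀ xs → length (filter P? xs) + length (filter (∁? P?) xs) ≡ length xs
    length-filter+filter∁ []       = refl
    length-filter+filter∁ (x ∷ xs) with P? x
    ... | yes _ = cong suc (length-filter+filter∁ xs)
    ... | no _  = trans (+-suc _ _) (cong suc (length-filter+filter∁ xs))

module _ {U : Set} where

  _∖_ : List U → Subset U → U → Set
  (S ∖ L) y = y ∈ S × L y ≡ false

  AtMostOne : (U → Set) → Set
  AtMostOne P = ∀ {y z} → P y → P z → y ≡ z

  AtMost-mono : ∀ {P Q : U → Set} {i} → P ⊆ Q → AtMost Q i → AtMost P i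
  AtMost-mono P⊆Q at ys u ps = at ys u (All.map P⊆Q ps)

  AtMost-weaken : ∀ {P : U → Set} {i j} → i ≤ j → AtMost P i → AtMost P j
  AtMost-weaken i≤j at ys u ps = ≤-trans (at ys u ps) i≤j

  ⊆⇒AtMost-∖ : ∀ {A L i} → (_∈ A) ⊆ (λ y → L y ≡ true) → AtMost (A ∖ L) i
  ⊆⇒AtMost-∖ A⊆L []      _ _                = z≤n
  ⊆⇒AtMost-∖ A⊆L (_ ∷ _) _ ((y∈A , Ly) ∷ _) = ⊥-elim (not-¬ (A⊆L y∈A) Ly)

  AtMost-∈ : ∀ (xs : List U) → AtMost (_∈ xs) (length xs)
  AtMost-∈ xs ys u ys⊆xs = length-mono-⊆ u (All.lookup ys⊆xs)

  AtMostOne⇒AtMost1 : ∀ {P : U → Set} → AtMostOne P → AtMost P 1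
  AtMostOne⇒AtMost1 one []          _               _             = z≤n
  AtMostOne⇒AtMost1 one (_ ∷ [])    _               _             = s≤s z≤n
  AtMostOne⇒AtMost1 one (_ ∷ _ ∷ _) ((y≢z ∷ _) ∷ _) (py ∷ pz ∷ _) = ⊥-elim (y≢z (one py pz))

  FiniteSet-mono : ∀ {P Q : U → Set} → P ⊆ Q → FiniteSet Q → FiniteSet P
  FiniteSet-mono P⊆Q (d , at) = d , AtMost-mono P⊆Q at

  length-≤-misses+filter : ∀ {S L i} → Unique S → AtMost (S ∖ L) i →
                           length S ≤ i + length (filter (λ y → L y ≟ true) S)
  length-≤-misses+filter {S} {L} {i} uS at = begin
    length S                                ≡⟨ length-filter+filter∁ L? S ⟨
    length (filter L? S) + length misses    ≤⟨ +-monoʳ-≤ (length (filter L? S)) misses≤i ⟩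
    length (filter L? S) + i                ≡⟨ +-comm _ i ⟩
    i + length (filter L? S)                ∎
    where
    open ≤-Reasoning
    L? : Decidable (λ y → L y ≡ true)
    L? y = L y ≟ true
    misses : List U
    misses = filter (∁? L?) S
    misses≤i : length misses ≤ i
    misses≤i = at misses (Unique.filter⁺ (∁? L?) uS)
                 (All.tabulate λ y∈ → let y∈S , ¬Ly = ∈-filter⁻ (∁? L?) y∈ in y∈S , ¬-not ¬Ly)

  module _ {C : Collection U} where

    closure-antitone : ∀ {S T i j} → (InCS C S i ⊆ InCS C T j) → ∃ (InCS C S i) →
                       InClosure C T j ⊆ InClosure C S i
    closure-antitone sub nonempty (_ , inAll) = nonempty , λ L L∈ → inAll L (sub L∈)

    closure-⊈-finite : ∀ {S i d} {Q : U → Set} → NCBound C i d → Unique S → d < length S →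
                       ∃ (InCS C S i) → FiniteSet Q → ¬ (InClosure C S i ⊆ Q)
    closure-⊈-finite nc uS d<|S| nonempty finQ cl⊆Q =
      <⇒≱ d<|S| (nc _ uS nonempty (FiniteSet-mono cl⊆Q finQ))

module Pinning {U : Set} (F : Subset U → Set) (S : List U) where

  Missed : U → Set
  Missed b = ∃ λ L → F L × L b ≡ false

  Pins : List U → U → Set
  Pins A b = ∀ {L} → F L → L b ≡ false → ∃ (S ∖ L) × (S ∖ L) ⊆ (_∈ A)

  Spread : List U → List U → Set
  Spread B T = ∀ {L} → F L → AtMostOne (B ∖ L) × (∀ {b} → (B ∖ L) b → (S ∖ L) ⊆ (_∈ T))

  spread-∷ : ∀ A {R B b} → Unique (A ++ R) → Missed b → Pins A b → Unique B → Spread B R →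
             Unique (b ∷ B) × Spread (b ∷ B) (A ++ R)
  spread-∷ A {R} {B} {b} uAR (L₁ , FL₁ , L₁b) b-pins uB B-spread =
    ¬Any⇒All¬ B (λ b∈B → apart FL₁ L₁b (b∈B , L₁b)) ∷ uB , b∷B-spread
    where
    -- S ∖ L is nonempty and would lie in both of the disjoint blocks A and R.
    apart : ∀ {L b′} → F L → L b ≡ false → ¬ (B ∖ L) b′
    apart FL Lb b′∈B∖L with y , y∈S∖L ← proj₁ (b-pins FL Lb) =
      Unique-++⇒disjoint A uAR (proj₂ (b-pins FL Lb) y∈S∖L) (proj₂ (B-spread FL) b′∈B∖L y∈S∖L)

    b∷B-spread : Spread (b ∷ B) (A ++ R)
    b∷B-spread {L} FL = one , confined
      where
      one : AtMostOne ((b ∷ B) ∖ L)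
      one (here refl , _)  (here refl , _)  = refl
      one (here refl , Lb) (there q , Lz)   = ⊥-elim (apart FL Lb (q , Lz))
      one (there p , Ly)   (here refl , Lb) = ⊥-elim (apart FL Lb (p , Ly))
      one (there p , Ly)   (there q , Lz)   = proj₁ (B-spread FL) (p , Ly) (q , Lz)

      confined : ∀ {b′} → ((b ∷ B) ∖ L) b′ → (S ∖ L) ⊆ (_∈ A ++ R)
      confined (here refl , Lb) y∈S∖L = ∈-++⁺ˡ (proj₂ (b-pins FL Lb) y∈S∖L)
      confined (there p , Lb′)  y∈S∖L = ∈-++⁺ʳ A (proj₂ (B-spread FL) (p , Lb′) y∈S∖L)

  spread : ∀ k n T → Unique T → k * n ≤ length T →
           (∀ {A} → (_∈ A) ⊆ (_∈ T) → Unique A → length A ≡ n → ∃ λ b → Missed b × Pins A b) →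
           ∃ λ B → length B ≡ k × Unique B × Spread B T
  spread zero    n T _  _   _   = [] , refl , [] , λ _ → (λ { (() , _) }) , λ { (() , _) }
  spread (suc k) n T uT len pin =
    let b , b-missed , b-pins   = pin A⊆T (Unique.take⁺ n uT) |A|
        B , |B| , uB , B-spread = spread k n R (Unique.drop⁺ n uT) |R| (λ A⊆R → pin (λ y∈ → R⊆T (A⊆R y∈)))
        ub∷B , b∷B-spread       = spread-∷ A (subst Unique (sym A++R≡T) uT) b-missed b-pins uB B-spread
    in b ∷ B , cong suc |B| , ub∷B , subst (Spread (b ∷ B)) A++R≡T b∷B-spread
    where
    A R : List U
    A = take n T
    R = drop n T

    A++R≡T : A ++ R ≡ T
    A++R≡T = take++drop≡id n T

    A⊆T : (_∈ A) ⊆ (_∈ T)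
    A⊆T y∈A = subst (_ ∈_) A++R≡T (∈-++⁺ˡ y∈A)

    R⊆T : (_∈ R) ⊆ (_∈ T)
    R⊆T y∈R = subst (_ ∈_) A++R≡T (∈-++⁺ʳ A y∈R)

    |A| : length A ≡ n
    |A| = trans (length-take n T) (m≤n⇒m⊓n≡m (≤-trans (m≤m+n n (k * n)) len))

    |T| : length T ≡ n + length R
    |T| = begin
      length T             ≡⟨ cong length A++R≡T ⟨
      length (A ++ R)      ≡⟨ length-++ A ⟩
      length A + length R  ≡⟨ cong (_+ length R) |A| ⟩
      n + length R         ∎
      where open ≡-Reasoning

    |R| : k * n ≤ length R
    |R| = +-cancelˡ-≤ n _ _ (subst (n + k * n ≤_) |T| len)

ncBound : ℕ → ℕ → ℕ
ncBound d zero    = d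
ncBound d (suc m) = suc (suc m) + suc d * suc (ncBound d m)

module Classical (dne : DoubleNegationElimination 0ℓ) where

  ¬⊆⇒∃ : ∀ {A : Set} {P Q : A → Set} → ¬ (P ⊆ Q) → ∃ λ y → P y × ¬ Q y
  ¬⊆⇒∃ P⊈Q = dne λ noWitness → P⊈Q λ {y} py → dne λ ¬qy → noWitness (y , py , ¬qy)

  module _ {U : Set} where

    ¬AtMost⇒long : ∀ {P : U → Set} {n} → ¬ AtMost P n → ∃ λ ys → Unique ys × All P ys × n < length ys
    ¬AtMost⇒long ¬at = dne λ noLong → ¬at λ ys u ps → ≮⇒≥ λ n<|ys| → noLong (ys , u , ps , n<|ys|)

    AtMost-saturated : ∀ {Q : U → Set} {n ys} → AtMost Q n → Unique ys → All Q ys → n ≤ length ys →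
                       Q ⊆ (_∈ ys)
    AtMost-saturated {ys = ys} at u qs n≤|ys| {y} qy = dne λ y∉ys →
      1+n≰n (≤-trans (at (y ∷ ys) (¬Any⇒All¬ ys y∉ys ∷ u) (qy ∷ qs)) n≤|ys|)

    module Pin {C : Collection U} {m e} (ncm : NCBound C m e) {S : List U} (uS : Unique S)
               {L₀} (L₀∈ : InCS C S (suc m) L₀) (fin : FiniteSet (InClosure C S (suc m))) where

      open Pinning (InCS C S (suc m)) S

      L₀? : Decidable (λ y → L₀ y ≡ true)
      L₀? y = L₀ y ≟ true

      S₀ : List U
      S₀ = filter L₀? S

      length-S₀ : ∀ {n} → suc m + n < length S → n ≤ length S₀
      length-S₀ long = <⇒≤ (+-cancelˡ-< (suc m) _ _ (<-≤-trans long (length-≤-misses+filter uS (proj₂ L₀∈))))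

      missed : ∀ {b} → ¬ InClosure C S (suc m) b → Missed b
      missed b∉⟨S⟩ with L , L∈ , ¬Lb ← ¬⊆⇒∃ (λ inAll → b∉⟨S⟩ ((L₀ , L₀∈) , λ _ L∈ → inAll L∈)) =
        L , L∈ , ¬-not ¬Lb

      pins : ∀ {A b} → (_∈ A) ⊆ (_∈ S) → InClosure C A m b → Pins A b
      pins {A} A⊆S b∈⟨A⟩ {L} L∈ Lb with ¬AtMost⇒long (λ at → not-¬ (proj₂ b∈⟨A⟩ L (proj₁ L∈ , at)) Lb)
      ... | []     , _ , _ , ()
      ... | y ∷ ys , u , ps@(y∈A∖L ∷ _) , m<|ys| =
        (y , A∖L⊆S∖L y∈A∖L) ,
        λ z∈S∖L → proj₁ (All.lookup ps (AtMost-saturated (proj₂ L∈) u (All.map A∖L⊆S∖L ps) m<|ys| z∈S∖L))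
        where
        A∖L⊆S∖L : (A ∖ L) ⊆ (S ∖ L)
        A∖L⊆S∖L (y∈A , Ly) = A⊆S y∈A , Ly

      pin : ∀ {A} → (_∈ A) ⊆ (_∈ S₀) → Unique A → length A ≡ suc e → ∃ λ b → Missed b × Pins A b
      pin {A} A⊆S₀ uA |A| =
        let b , b∈⟨A⟩ , b∉⟨S⟩ = ¬⊆⇒∃ (closure-⊈-finite ncm uA (≤-reflexive (sym |A|)) (L₀ , proj₁ L₀∈ , L₀∈C[A]) fin)
        in b , missed b∉⟨S⟩ , pins (λ y∈A → proj₁ (∈-filter⁻ L₀? {xs = S} (A⊆S₀ y∈A))) b∈⟨A⟩
        where
        L₀∈C[A] : AtMost (A ∖ L₀) m
        L₀∈C[A] = ⊆⇒AtMost-∖ (λ y∈A → proj₂ (∈-filter⁻ L₀? {xs = S} (A⊆S₀ y∈A)))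

      pinned-sample : ∀ k → k * suc e ≤ length S₀ →
                      ∃ λ B → length B ≡ k × Unique B × InCS C S (suc m) ⊆ InCS C B 1
      pinned-sample k len =
        let B , |B| , uB , B-spread = spread k (suc e) S₀ (Unique.filter⁺ L₀? uS) len pin
        in B , |B| , uB , λ L∈ → proj₁ L∈ , AtMostOne⇒AtMost1 (proj₁ (B-spread L∈))

  NCBound-suc : ∀ {U} {C : Collection U} {m d e} → NCBound C 1 d → NCBound C m e →
                NCBound C (suc m) (suc m + suc d * suc e)
  NCBound-suc {d = d} nc1 ncm S uS (L₀ , L₀∈) fin = ≮⇒≥ λ long →
    let B , |B| , uB , C[S]⊆C[B] = pinned-sample (suc d) (length-S₀ long)
        ⟨B⟩-finite = FiniteSet-mono (closure-antitone C[S]⊆C[B] (L₀ , L₀∈)) fin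
    in 1+n≰n (subst (_≤ d) |B| (nc1 B uB (L₀ , C[S]⊆C[B] L₀∈) ⟨B⟩-finite))
    where open Pin ncm uS L₀∈ fin

  NCBound-all : ∀ {U} {C : Collection U} {d} → NCBound C 1 d → ∀ m → NCBound C (suc m) (ncBound d m)
  NCBound-all nc1 zero    = nc1
  NCBound-all nc1 (suc m) = NCBound-suc nc1 (NCBound-all nc1 m)

-- The largest i ≤ a with f i < w, and 0 if there is none (f 0 itself is never tested).
maxBelow : (ℕ → ℕ) → ℕ → ℕ → ℕ
maxBelow f zero    w = zero
maxBelow f (suc a) w with f (suc a) <? w
... | yes _ = suc a
... | no _  = maxBelow f a w

maxBelow-spec : ∀ f a w {j} → j ≤ a → f j < w → j ≤ maxBelow f a w × f (maxBelow f a w) < w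
maxBelow-spec f zero    w z≤n   fj<w = z≤n , fj<w
maxBelow-spec f (suc a) w j≤1+a fj<w with f (suc a) <? w | m≤n⇒m<n∨m≡n j≤1+a
... | yes fa<w | _         = j≤1+a , fa<w
... | no _     | inj₁ j≤a  = maxBelow-spec f a w (s≤s⁻¹ j≤a) fj<w
... | no fa≮w  | inj₂ refl = ⊥-elim (fa≮w fj<w)

module _ {U : Set} {x : ℕ → U} where

  length-prefix : ∀ t → length (prefix x t) ≡ suc t
  length-prefix t = trans (length-map x (upTo (suc t))) (length-upTo (suc t))

  prefix-unique : Injective _≡_ _≡_ x → ∀ t → Unique (prefix x t)
  prefix-unique x-inj t = Unique.map⁺ x-inj (Unique.upTo⁺ (suc t))

  prefix-noise : ∀ {K n} → Enumeration K n x → ∀ t → AtMost (prefix x t ∖ K) n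
  prefix-noise {K} (_ , _ , noise) t = AtMost-mono in-range noise
    where
    in-range : (prefix x t ∖ K) ⊆ (λ y → (∃ λ j → x j ≡ y) × K y ≡ false)
    in-range (y∈ , Ky) = let j , _ , y≡xj = ∈-map⁻ x y∈ in (j , sym y≡xj) , Ky

module Generator (em : ExcludedMiddle 0ℓ) {U : Set} (default : U)
                 (Cs : ℕ → Collection U) (Cs-suc : ∀ i L → Cs i L → Cs (suc i) L)
                 (bound : ℕ → ℕ) (Cs-bound : ∀ k → NCBound (Cs k) (suc k) (bound k)) where

  open Classical (em⇒dne em)

  level : List U → ℕ
  level xs = maxBelow bound (length xs) (length xs)

  Fresh : List U → U → Set
  Fresh xs y = InClosure (Cs (level xs)) xs (suc (level xs)) y × y ∉ xs

  generator : List U → U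
  generator xs with em {∃ (Fresh xs)}
  ... | yes (y , _) = y
  ... | no _        = default

  generator-fresh : ∀ xs → ∃ (Fresh xs) → Fresh xs (generator xs)
  generator-fresh xs fresh with em {∃ (Fresh xs)}
  ... | yes (_ , y-fresh) = y-fresh
  ... | no no-fresh       = ⊥-elim (no-fresh fresh)

  Cs-mono : ∀ {i j L} → i ≤ j → Cs i L → Cs j L
  Cs-mono i≤j = Cs-mono′ (≤⇒≤′ i≤j)
    where
    Cs-mono′ : ∀ {i j L} → i ≤′ j → Cs i L → Cs j L
    Cs-mono′ ≤′-refl        L∈ = L∈
    Cs-mono′ (≤′-step i≤′j) L∈ = Cs-suc _ _ (Cs-mono′ i≤′j L∈)

  generator-generates : ∀ {C : Collection U} → (∀ {L} → C L → ∃ λ i → Cs i L) →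
                        NonUniformlyGenerates C generator
  generator-generates C⊆⋃Cs n K K∈C = k₀ + bound k₀ , generates-from
    where
    i k₀ : ℕ
    i = proj₁ (C⊆⋃Cs K∈C)
    k₀ = i + n

    generates-from : ∀ x → Enumeration K n x → ∀ t → k₀ + bound k₀ ≤ t →
                     K (generator (prefix x t)) ≡ true × generator (prefix x t) ∉ prefix x t
    generates-from x enum@(x-inj , _) t late = proj₂ (proj₁ fresh) K K∈C[xs] , proj₂ fresh
      where
      xs : List U
      xs = prefix x t

      k : ℕ
      k = level xs

      k₀≤|xs| : k₀ ≤ length xs
      k₀≤|xs| = subst (k₀ ≤_) (sym (length-prefix t)) (≤-trans (m≤m+n k₀ _) (≤-trans late (n≤1+n t)))

      bound-k₀<|xs| : bound k₀ < length xs
      bound-k₀<|xs| = subst (bound k₀ <_) (sym (length-prefix t)) (s≤s (≤-trans (m≤n+m _ k₀) late))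

      k-spec : k₀ ≤ k × bound k < length xs
      k-spec = maxBelow-spec bound (length xs) (length xs) k₀≤|xs| bound-k₀<|xs|

      K∈C[xs] : InCS (Cs k) xs (suc k) K
      K∈C[xs] = Cs-mono (≤-trans (m≤m+n i n) (proj₁ k-spec)) (proj₂ (C⊆⋃Cs K∈C))
              , AtMost-weaken (≤-trans (m≤n+m n i) (≤-trans (proj₁ k-spec) (n≤1+n k))) (prefix-noise enum t)

      fresh : Fresh xs (generator xs)
      fresh = generator-fresh xs (¬⊆⇒∃ (closure-⊈-finite (Cs-bound k) (prefix-unique x-inj t) (proj₂ k-spec)
                                          (K , K∈C[xs]) (length xs , AtMost-∈ xs)))

mainTheorem6 : ExcludedMiddle 0ℓ →
    (U : Set) → ℕ ↔ U →
    (C : Collection U) → (∀ L → C L → Infinite L) →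
    (Cs : ℕ → Collection U) →
    (∀ i L → Cs i L → Cs (suc i) L) →
    (∀ L → C L ⇔ ∃ (λ i → Cs i L)) →
    (∀ i → NCFinite (Cs i) 1) →
    NonUniformlyGeneratable C
-- The bijection ℕ ↔ U only supplies a default output.
mainTheorem6 em U ℕ↔U C _ Cs Cs-suc C⇔⋃Cs NC₁-finite =
  generator , generator-generates (λ {L} → Equivalence.to (C⇔⋃Cs L))
  where
  bound : ℕ → ℕ
  bound k = ncBound (proj₁ (NC₁-finite k)) k

  open Classical (em⇒dne em) using (NCBound-all)
  open Generator em (Inverse.to ℕ↔U 0) Cs Cs-suc bound (λ k → NCBound-all (proj₂ (NC₁-finite k)) k)
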